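{- For every odd integer $d\ge 5$ there exists a regular map of valency $d$ which is both self-dual and self-Petrie-dual.
   Context: A regular map is identified with a quadruple $M=(G;x,y,z)$ where $G$ is a finite group generated by three involutions $x,y,z$ such that $x$ and $y$ commute ($(xy)^2=1$); here $G\cong\mathrm{Aut}(M)$, the automorphism group of the map, which acts regularly on the flags. If $yz$ has order $k$ and $zx$ has order $\ell$, the pair $(k,\ell)$ is the type of $M$ (with $k,\ell\ge 3$); $k$ is the valency of $M$ (every vertex has valency $k$) and $\ell$ is the face length. The map $M$ is self-dual (isomorphic to its dual) if and only if $G$ has a group automorphism interchanging $x$ and $y$ and fixing $z$; it is self-Petrie-dual (isomorphic to its Petrie dual) if and only if $G$ has a group automorphism interchanging $x$ and $xy$ and fixing $y$ and $z$. -}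

module Defs where

open import Level using (0ℓ; Level)
open import Algebra.Bundles using (Group)
open import Data.Nat using (ℕ; zero; suc; _<_; _≤_)
open import Data.Fin using (Fin)
open import Data.List using (List; []; _∷_; foldr)
open import Data.Product using (Σ; ∃; _×_; _,_)
open import Relation.Nullary using (¬_)

module _ (G : Group 0ℓ 0ℓ) where
  open Group G

  pow : Carrier → ℕ → Carrier
  pow g zero    = ε
  pow g (suc n) = g ∙ pow g n

  HasOrder : Carrier → ℕ → Set
  HasOrder g k = (1 ≤ k) × (pow g k ≈ ε) × (∀ j → 1 ≤ j → j < k → ¬ (pow g j ≈ ε))

  IsInvolution : Carrier → Set
  IsInvolution g = HasOrder g 2

  IsFinite : Set
  IsFinite = Σ ℕ λ n → Σ (Fin n → Carrier) λ f → ∀ g → ∃ λ i → f i ≈ g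

  evalWord : List Carrier → Carrier
  evalWord = foldr _∙_ ε


  GeneratedBy₃ : Carrier → Carrier → Carrier → Set
  GeneratedBy₃ x y z =
    ∀ g → ∃ λ (w : List (Fin 3)) → evalWord (Data.List.map pick w) ≈ g
    where
    open import Data.List using (map)
    pick : Fin 3 → Carrier
    pick Fin.zero = x
    pick (Fin.suc Fin.zero) = y
    pick (Fin.suc (Fin.suc Fin.zero)) = z

  record Automorphism : Set where
    field
      φ        : Carrier → Carrier
      φ-cong   : ∀ {a b} → a ≈ b → φ a ≈ φ b
      φ-hom    : ∀ a b → φ (a ∙ b) ≈ φ a ∙ φ b
      φ-inj    : ∀ {a b} → φ a ≈ φ b → a ≈ b
      φ-surj   : ∀ b → ∃ λ a → φ a ≈ b

record RegularMap : Set₁ where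
  field
    G : Group 0ℓ 0ℓ
  open Group G
  field
    finite : IsFinite G
    x y z  : Carrier
    x-inv  : IsInvolution G x
    y-inv  : IsInvolution G y
    z-inv  : IsInvolution G z
    xy-comm : pow G (x ∙ y) 2 ≈ ε
    gen    : GeneratedBy₃ G x y z

module _ (M : RegularMap) where
  open RegularMap M
  open Group G

  HasType : ℕ → ℕ → Set
  HasType k l = HasOrder G (y ∙ z) k × HasOrder G (z ∙ x) l × (3 ≤ k) × (3 ≤ l)

  HasValency : ℕ → Set
  HasValency k = HasOrder G (y ∙ z) k

  SelfDual : Set
  SelfDual = ∃ λ (α : Automorphism G) → let open Automorphism α in
    (φ x ≈ y) × (φ y ≈ x) × (φ z ≈ z)

  SelfPetrieDual : Set
  SelfPetrieDual = ∃ λ (α : Automorphism G) → let open Automorphism α in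
    (φ x ≈ x ∙ y) × (φ (x ∙ y) ≈ x) × (φ y ≈ y) × (φ z ≈ z)

module Submission where

-- Let X, Y be commuting involutions and Z an involution of a finite set such that ZX, ZY and ZXY
-- all have order d. Take six copies of the set, one for each ordered pair (f, s) of distinct
-- elements of {X, Y, XY}, and let x act as f, y as s and z as Z on each copy. The group generated
-- by x, y, z is then the automorphism group of a regular map of type (d, d), and permuting the copies
-- realises the automorphisms x ↔ y and x ↔ xy fixing z, so the map is self-dual and self-Petrie-dual.
-- Such configurations are given explicitly for d = 5, 7, 15. For the other odd d ≥ 9 they come from
-- chains: if e is fixed by X and Y and, for W = X, Y, XY, the ⟨Z, W⟩-orbit of e is a path of length d
-- outside of which ZW is trivial, then ZW has order d; inserting a fixed gadget into the Z-edge at e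
-- lengthens all three paths by 8 (or 12), starting from explicit chains for d = 9, 11, 13.

open import Level using (0ℓ)
open import Algebra.Bundles using (Group)
open import Algebra.Structures using (IsGroup)
open import Data.Empty using (⊥; ⊥-elim)
open import Data.Fin as Fin
  using (Fin; zero; suc; #_; toℕ; combine; remQuot; _↑ˡ_; _↑ʳ_; splitAt; funToFin; finToFun)
import Data.Fin.Properties as Finₚ
open import Data.Vec as Vec using ([]; _∷_)
open import Data.List
  using (List; []; _∷_; [_]; _++_; reverse; length; map; concat; concatMap; take; drop; lookup; allFin;
         cartesianProductWith)
open import Data.List.Properties
  using (++-assoc; ++-identityʳ; reverse-involutive; unfold-reverse; take++drop≡id; map-++; concat-++;
         length-++; length-map; length-drop)
open import Data.List.Membership.Propositional using (_∈_; _∉_)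
open import Data.List.Membership.Propositional.Properties
  using (∈-++⁺ˡ; ∈-++⁺ʳ; ∈-++⁻; ∈-map⁺; ∈-map⁻; ∈-allFin; ∈-cartesianProductWith⁺)
open import Data.List.Relation.Unary.Any using (here; there) renaming (index to position)
open import Data.List.Relation.Unary.Any.Properties using (lookup-index)
open import Data.Nat using (ℕ; zero; suc; _+_; _∸_; _*_; _^_; _≤_; _<_; z≤n; s≤s; _≤?_; _≟_)
open import Data.Nat.GeneralisedArithmetic using (fold; fold-+)
open import Data.Nat.Induction using (<-wellFounded)
open import Data.Nat.Tactic.RingSolver using (solve-∀)
open import Data.Nat.Properties
  using (≤-refl; ≤-trans; ≤-reflexive; <⇒≤; ≤-pred; n<1+n; ≰⇒>; <⇒≱; <⇒≢; ≤∧≢⇒<; +-comm; +-suc; +-identityʳ;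
         m∸n≤m; m∸n+n≡m; m+n∸m≡n; m<n⇒0<n∸m; ∸-monoʳ-≤; allUpTo?)
open import Data.Product using (Σ; ∃; _×_; _,_; proj₁; proj₂)
open import Data.Sum as Sum using (_⊎_; inj₁; inj₂; [_,_]′)
import Data.Sum.Properties as Sumₚ
open import Defs
open import Function using (_∘_)
open import Induction.WellFounded using (Acc; acc)
open import Relation.Binary.Definitions using (DecidableEquality)
open import Relation.Binary.PropositionalEquality hiding ([_])
open import Relation.Nullary using (Dec; yes; no; map′; ¬?)
open import Relation.Nullary.Decidable using (_×-dec_; _⊎-dec_; _→-dec_; True; toWitness; from-yes)

fold-suc : ∀ {A : Set} (a : A) (f : A → A) k → fold a f (suc k) ≡ fold (f a) f k
fold-suc a f k = trans (cong (fold a f) (+-comm 1 k)) (fold-+ a f k)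

fold-fixed : ∀ {A : Set} {a : A} (f : A → A) → f a ≡ a → ∀ k → fold a f k ≡ a
fold-fixed f fa≡a zero = refl
fold-fixed f fa≡a (suc k) = trans (cong f (fold-fixed f fa≡a k)) fa≡a

fold-inverse : ∀ {A : Set} (f g : A → A) → (∀ a → g (f a) ≡ a) → ∀ a k → fold (fold a f k) g k ≡ a
fold-inverse f g g∘f a zero    = refl
fold-inverse f g g∘f a (suc k) =
  trans (fold-suc (f (fold a f k)) g k) (trans (cong (λ b → fold b g k) (g∘f _)) (fold-inverse f g g∘f a k))

fold-commute : ∀ {A : Set} (f g : A → A) → (∀ a → f (g a) ≡ g (f a)) → ∀ a m n → fold (fold a g m) f n ≡ fold (fold a f n) g m
fold-commute f g fg≡gf a m zero    = refl
fold-commute f g fg≡gf a m (suc n) = trans (cong f (fold-commute f g fg≡gf a m n)) (pull m (fold a f n))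
  where
  pull : ∀ m b → f (fold b g m) ≡ fold (f b) g m
  pull zero    b = refl
  pull (suc m) b = trans (fg≡gf (fold b g m)) (cong g (pull m b))

fold-conjugate : ∀ {A : Set} (f g Q : A → A) → (∀ a → Q (Q a) ≡ a) → (∀ a → g (Q a) ≡ Q (f a)) →
                 ∀ a k → fold a g k ≡ Q (fold (Q a) f k)
fold-conjugate f g Q QQ g∘Q a zero = sym (QQ a)
fold-conjugate f g Q QQ g∘Q a (suc k) =
  trans (cong g (fold-conjugate f g Q QQ g∘Q a k)) (g∘Q (fold (Q a) f k))

fold-fibre : ∀ {C P : Set} (f : C × P → C × P) (g : C → P → P) → (∀ c p → f (c , p) ≡ (c , g c p)) →
             ∀ c p k → fold (c , p) f k ≡ (c , fold p (g c) k)
fold-fibre f g f≡g c p zero = refl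
fold-fibre f g f≡g c p (suc k) = trans (cong f (fold-fibre f g f≡g c p k)) (f≡g c (fold p (g c) k))

HasOrderᶠ : {A : Set} → (A → A) → ℕ → Set
HasOrderᶠ f d = (∀ a → fold a f d ≡ a) × (∀ j → 1 ≤ j → j < d → ∃ λ a → fold a f j ≢ a)

involution-hasOrder : ∀ {A : Set} (f : A → A) → (∀ a → f (f a) ≡ a) → (∃ λ a → f a ≢ a) → HasOrderᶠ f 2
involution-hasOrder f ff (a , fa≢a) = ff , λ where
  1 _ _ → a , fa≢a
  (suc (suc j)) _ (s≤s (s≤s ()))

involution-injective : ∀ {A : Set} (Q : A → A) → (∀ a → Q (Q a) ≡ a) → ∀ {a b} → Q a ≡ Q b → a ≡ b
involution-injective Q QQ {a} {b} Qa≡Qb = trans (sym (QQ a)) (trans (cong Q Qa≡Qb) (QQ b))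

hasOrder-conjugate : ∀ {A : Set} {d} (f g Q : A → A) → (∀ a → Q (Q a) ≡ a) → (∀ a → g (Q a) ≡ Q (f a)) →
                     HasOrderᶠ f d → HasOrderᶠ g d
hasOrder-conjugate {d = d} f g Q QQ g∘Q (fᵈ≡id , fʲ≢id) =
  (λ a → trans (conj a d) (trans (cong Q (fᵈ≡id (Q a))) (QQ a))) ,
  λ j 1≤j j<d → let (a , fʲa≢a) = fʲ≢id j 1≤j j<d in
    Q a , λ gʲQa≡Qa → fʲa≢a (begin
      fold a f j         ≡⟨ cong (λ b → fold b f j) (sym (QQ a)) ⟩
      fold (Q (Q a)) f j ≡⟨ involution-injective Q QQ (trans (sym (conj (Q a) j)) gʲQa≡Qa) ⟩
      a                  ∎)
  where
  open ≡-Reasoning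
  conj : ∀ a k → fold a g k ≡ Q (fold (Q a) f k)
  conj = fold-conjugate f g Q QQ g∘Q

hasOrder-fibrewise : ∀ {C P : Set} {d} (c₀ : C) (f : C × P → C × P) (g : C → P → P) →
                     (∀ c p → f (c , p) ≡ (c , g c p)) → (∀ c → HasOrderᶠ (g c) d) → HasOrderᶠ f d
hasOrder-fibrewise {d = d} c₀ f g f≡g ord =
  (λ (c , p) → trans (fibre c p d) (cong (c ,_) (proj₁ (ord c) p))) ,
  λ j 1≤j j<d → let (p , gʲp≢p) = proj₂ (ord c₀) j 1≤j j<d in
    (c₀ , p) , λ fʲ≡ → gʲp≢p (cong proj₂ (trans (sym (fibre c₀ p j)) fʲ≡))
  where
  fibre : ∀ c p k → fold (c , p) f k ≡ (c , fold p (g c) k)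
  fibre = fold-fibre f g f≡g

record Enumeration (T : Set) : Set where
  field
    size          : ℕ
    index         : T → Fin size
    element       : Fin size → T
    element-index : ∀ t → element (index t) ≡ t

  index-injective : ∀ {s t} → index s ≡ index t → s ≡ t
  index-injective {s} {t} eq = trans (sym (element-index s)) (trans (cong element eq) (element-index t))

  ≡-dec : DecidableEquality T
  ≡-dec s t = map′ index-injective (cong index) (index s Fin.≟ index t)

enumerateFin : ∀ n → Enumeration (Fin n)
enumerateFin n = record { size = n ; index = λ i → i ; element = λ i → i ; element-index = λ i → refl }

enumerate-× : ∀ {A B : Set} → Enumeration A → Enumeration B → Enumeration (A × B)
enumerate-× EA EB = record
  { size = A.size * B.size
  ; index = λ (a , b) → combine (A.index a) (B.index b)
  ; element = λ k → let (i , j) = remQuot B.size k in A.element i , B.element j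
  ; element-index = λ (a , b) →
      trans (cong (λ (i , j) → A.element i , B.element j) (Finₚ.remQuot-combine (A.index a) (B.index b)))
            (cong₂ _,_ (A.element-index a) (B.element-index b))
  }
  where
  module A = Enumeration EA
  module B = Enumeration EB

enumerate-⊎ : ∀ {A B : Set} → Enumeration A → Enumeration B → Enumeration (A ⊎ B)
enumerate-⊎ EA EB = record
  { size = A.size + B.size
  ; index = [ (λ a → A.index a ↑ˡ B.size) , (λ b → A.size ↑ʳ B.index b) ]′
  ; element = Sum.map A.element B.element ∘ splitAt A.size
  ; element-index = λ where
      (inj₁ a) → trans (cong (Sum.map A.element B.element) (Finₚ.splitAt-↑ˡ A.size (A.index a) B.size))
                       (cong inj₁ (A.element-index a))
      (inj₂ b) → trans (cong (Sum.map A.element B.element) (Finₚ.splitAt-↑ʳ A.size B.size (B.index b)))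
                       (cong inj₂ (B.element-index b))
  }
  where
  module A = Enumeration EA
  module B = Enumeration EB

module WordGroup {T : Set} (enum : Enumeration T) (gen : Fin 3 → T → T)
                 (gen-involutive : ∀ a t → gen a (gen a t) ≡ t) where
  open Enumeration enum using (size; index; element; element-index; index-injective)

  Word : Set
  Word = List (Fin 3)

  act : Word → T → T
  act []      t = t
  act (a ∷ w) t = gen a (act w t)

  infix 4 _≈_
  _≈_ : Word → Word → Set
  u ≈ v = ∀ t → act u t ≡ act v t

  act-++ : ∀ u v t → act (u ++ v) t ≡ act u (act v t)
  act-++ []      v t = refl
  act-++ (a ∷ u) v t = cong (gen a) (act-++ u v t)

  act-reverse : ∀ w t → act (reverse w) (act w t) ≡ t
  act-reverse []      t = refl
  act-reverse (a ∷ w) t = begin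
    act (reverse (a ∷ w)) (gen a (act w t))    ≡⟨ cong (λ u → act u (gen a (act w t))) (unfold-reverse a w) ⟩
    act (reverse w ++ [ a ]) (gen a (act w t)) ≡⟨ act-++ (reverse w) [ a ] _ ⟩
    act (reverse w) (gen a (gen a (act w t)))  ≡⟨ cong (act (reverse w)) (gen-involutive a _) ⟩
    act (reverse w) (act w t)                  ≡⟨ act-reverse w t ⟩
    t                                          ∎
    where open ≡-Reasoning

  act-reverse′ : ∀ w t → act w (act (reverse w) t) ≡ t
  act-reverse′ w t =
    trans (cong (λ u → act u (act (reverse w) t)) (sym (reverse-involutive w))) (act-reverse (reverse w) t)

  isGroup : IsGroup _≈_ _++_ [] reverse
  isGroup = record
    { isMonoid = record
      { isSemigroup = record
        { isMagma = record
          { isEquivalence = record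
            { refl = λ t → refl ; sym = λ p t → sym (p t) ; trans = λ p q t → trans (p t) (q t) }
          ; ∙-cong = λ {u} {u′} {v} {v′} u≈u′ v≈v′ t → begin
              act (u ++ v) t     ≡⟨ act-++ u v t ⟩
              act u (act v t)    ≡⟨ cong (act u) (v≈v′ t) ⟩
              act u (act v′ t)   ≡⟨ u≈u′ _ ⟩
              act u′ (act v′ t)  ≡⟨ act-++ u′ v′ t ⟨
              act (u′ ++ v′) t   ∎
          }
        ; assoc = λ u v w t → cong (λ l → act l t) (++-assoc u v w)
        }
      ; identity = (λ u t → refl) , (λ u t → cong (λ l → act l t) (++-identityʳ u))
      }
    ; inverse = (λ u t → trans (act-++ (reverse u) u t) (act-reverse u t))
              , (λ u t → trans (act-++ u (reverse u) t) (act-reverse′ u t))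
    ; ⁻¹-cong = λ {u} {v} u≈v t → begin
        act (reverse u) t                            ≡⟨ act-reverse v _ ⟨
        act (reverse v) (act v (act (reverse u) t))  ≡⟨ cong (act (reverse v)) (u≈v _) ⟨
        act (reverse v) (act u (act (reverse u) t))  ≡⟨ cong (act (reverse v)) (act-reverse′ u t) ⟩
        act (reverse v) t                            ∎
    }
    where open ≡-Reasoning

  group : Group 0ℓ 0ℓ
  group = record { Carrier = Word ; _≈_ = _≈_ ; _∙_ = _++_ ; ε = [] ; _⁻¹ = reverse ; isGroup = isGroup }

  act-pow : ∀ w k t → act (pow group w k) t ≡ fold t (act w) k
  act-pow w zero    t = refl
  act-pow w (suc k) t = trans (act-++ w (pow group w k) t) (cong (act w) (act-pow w k t))

  hasOrder : ∀ {w d} → 1 ≤ d → HasOrderᶠ (act w) d → HasOrder group w d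
  hasOrder {w} {d} 1≤d (wᵈ≡id , wʲ≢id) =
    1≤d , (λ t → trans (act-pow w d t) (wᵈ≡id t)) ,
    λ j 1≤j j<d wʲ≈ε → let (t , wʲt≢t) = wʲ≢id j 1≤j j<d in wʲt≢t (trans (sym (act-pow w j t)) (wʲ≈ε t))

  generator-isInvolution : ∀ a → (∃ λ t → gen a t ≢ t) → IsInvolution group [ a ]
  generator-isInvolution a moved = hasOrder (s≤s z≤n) (involution-hasOrder (gen a) (gen-involutive a) moved)

  evalWord-singletons : (p : Fin 3 → Word) → (∀ a → p a ≈ [ a ]) → ∀ w → evalWord group (map p w) ≈ w
  evalWord-singletons p p≈ []      t = refl
  evalWord-singletons p p≈ (a ∷ w) t =
    trans (act-++ (p a) _ t) (trans (p≈ a _) (cong (gen a) (evalWord-singletons p p≈ w t)))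

  bound : ℕ
  bound = size ^ size

  table : Word → Fin bound
  table w = funToFin (λ i → index (act w (element i)))

  table-injective : ∀ u v → table u ≡ table v → u ≈ v
  table-injective u v eq t = begin
    act u t                   ≡⟨ cong (act u) (element-index t) ⟨
    act u (element (index t)) ≡⟨ index-injective (trans (entry u) (trans (cong (λ c → finToFun c (index t)) eq) (sym (entry v)))) ⟩
    act v (element (index t)) ≡⟨ cong (act v) (element-index t) ⟩
    act v t                   ∎
    where
    open ≡-Reasoning
    entry : ∀ w → index (act w (element (index t))) ≡ finToFun (table w) (index t)
    entry w = sym (Finₚ.finToFun-funToFin (λ i → index (act w (element i))) (index t))

  cut-shorter : ∀ (w : Word) i j → i < j → j ≤ length w → length (take i w ++ drop j w) < length w
  cut-shorter (a ∷ w) zero    (suc j) _         _ = s≤s (≤-trans (≤-reflexive (length-drop j w)) (m∸n≤m _ j))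
  cut-shorter (a ∷ w) (suc i) (suc j) (s≤s i<j) (s≤s j≤) = s≤s (cut-shorter w i j i<j j≤)

  cut-≈ : ∀ (w : Word) i j → take i w ≈ take j w → take i w ++ drop j w ≈ w
  cut-≈ w i j same t = begin
    act (take i w ++ drop j w) t       ≡⟨ act-++ (take i w) (drop j w) t ⟩
    act (take i w) (act (drop j w) t)  ≡⟨ same _ ⟩
    act (take j w) (act (drop j w) t)  ≡⟨ act-++ (take j w) (drop j w) t ⟨
    act (take j w ++ drop j w) t       ≡⟨ cong (λ u → act u t) (take++drop≡id j w) ⟩
    act w t                            ∎
    where open ≡-Reasoning

  -- Two of the bound + 1 prefixes of w act alike, so the segment between them can be cut out.
  shorten : ∀ w → bound < length w → ∃ λ w′ → length w′ < length w × w′ ≈ w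
  shorten w long =
    let (i , j , i<j , same) = Finₚ.pigeonhole (n<1+n bound) (λ (k : Fin (suc bound)) → table (take (toℕ k) w))
        j≤ = ≤-trans (≤-pred (Finₚ.toℕ<n j)) (<⇒≤ long)
    in take (toℕ i) w ++ drop (toℕ j) w , cut-shorter w (toℕ i) (toℕ j) i<j j≤ ,
       cut-≈ w (toℕ i) (toℕ j) (table-injective (take (toℕ i) w) (take (toℕ j) w) same)

  shortRepresentative : ∀ w → Acc _<_ (length w) → ∃ λ w′ → length w′ ≤ bound × w′ ≈ w
  shortRepresentative w (acc shorter-acc) with length w ≤? bound
  ... | yes short = w , short , λ t → refl
  ... | no ¬short =
    let (w₁ , shorter , w₁≈w) = shorten w (≰⇒> ¬short)
        (w₂ , short , w₂≈w₁) = shortRepresentative w₁ (shorter-acc shorter)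
    in w₂ , short , λ t → trans (w₂≈w₁ t) (w₁≈w t)

  wordsUpTo : ℕ → List Word
  wordsUpTo zero    = [ [] ]
  wordsUpTo (suc n) = [] ∷ cartesianProductWith _∷_ (allFin 3) (wordsUpTo n)

  ∈-wordsUpTo : ∀ n w → length w ≤ n → w ∈ wordsUpTo n
  ∈-wordsUpTo zero    []      _         = here refl
  ∈-wordsUpTo (suc n) []      _         = here refl
  ∈-wordsUpTo (suc n) (a ∷ w) (s≤s w≤n) = there (∈-cartesianProductWith⁺ _∷_ (∈-allFin a) (∈-wordsUpTo n w w≤n))

  finite : IsFinite group
  finite = length (wordsUpTo bound) , lookup (wordsUpTo bound) , λ w →
    let (w′ , short , w′≈w) = shortRepresentative w (<-wellFounded (length w))
        w′∈ = ∈-wordsUpTo bound w′ short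
    in position w′∈ , λ t → trans (cong (λ u → act u t) (sym (lookup-index w′∈))) (w′≈w t)

  substitute : (Fin 3 → Word) → Word → Word
  substitute = concatMap

  substitute-++ : ∀ s u v → substitute s (u ++ v) ≡ substitute s u ++ substitute s v
  substitute-++ s u v = trans (cong concat (map-++ s u v)) (sym (concat-++ (map s u) (map s v)))

  module _ (s : Fin 3 → Word) (σ : T → T) (σ-involutive : ∀ t → σ (σ t) ≡ t)
           (s-conjugates : ∀ a t → act (s a) (σ t) ≡ σ (gen a t)) where

    act-substitute : ∀ w t → act (substitute s w) (σ t) ≡ σ (act w t)
    act-substitute []      t = refl
    act-substitute (a ∷ w) t = begin
      act (s a ++ substitute s w) (σ t)      ≡⟨ act-++ (s a) (substitute s w) (σ t) ⟩
      act (s a) (act (substitute s w) (σ t)) ≡⟨ cong (act (s a)) (act-substitute w t) ⟩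
      act (s a) (σ (act w t))                ≡⟨ s-conjugates a (act w t) ⟩
      σ (gen a (act w t))                    ∎
      where open ≡-Reasoning

    act-substitute′ : ∀ w t → act (substitute s w) t ≡ σ (act w (σ t))
    act-substitute′ w t = trans (cong (act (substitute s w)) (sym (σ-involutive t))) (act-substitute w (σ t))

    conjugationAutomorphism : Automorphism group
    conjugationAutomorphism = record
      { φ      = substitute s
      ; φ-cong = λ {u} {v} u≈v t →
          trans (act-substitute′ u t) (trans (cong σ (u≈v (σ t))) (sym (act-substitute′ v t)))
      ; φ-hom  = λ u v t → cong (λ w → act w t) (substitute-++ s u v)
      ; φ-inj  = λ {u} {v} su≈sv t → involution-injective σ σ-involutive
          (trans (sym (act-substitute u t)) (trans (su≈sv (σ t)) (act-substitute v t)))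
      ; φ-surj = λ w → substitute s w , λ t →
          trans (act-substitute′ (substitute s w) t) (trans (cong σ (act-substitute w t)) (σ-involutive _))
      }

record Involutions : Set₁ where
  field
    Point        : Set
    enumeration  : Enumeration Point
    X Y Z        : Point → Point
    X-involutive : ∀ p → X (X p) ≡ p
    Y-involutive : ∀ p → Y (Y p) ≡ p
    Z-involutive : ∀ p → Z (Z p) ≡ p
    XY-commute   : ∀ p → X (Y p) ≡ Y (X p)
    X-moves      : ∃ λ p → X p ≢ p
    Z-moves      : ∃ λ p → Z p ≢ p

  XY-involutive : ∀ p → X (Y (X (Y p))) ≡ p
  XY-involutive p = trans (cong X (sym (XY-commute (Y p)))) (trans (X-involutive (Y (Y p))) (Y-involutive p))

record Configuration (d : ℕ) : Set₁ where
  field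
    involutions : Involutions
  open Involutions involutions public
  field
    ZX-order  : HasOrderᶠ (Z ∘ X) d
    ZY-order  : HasOrderᶠ (Z ∘ Y) d
    ZXY-order : HasOrderᶠ (Z ∘ X ∘ Y) d

data Label : Set where
  x y xy : Label

-- An ordered pair of distinct labels: the images of the map generators x and y.
data Copy : Set where
  ⟨x,y⟩ ⟨y,x⟩ ⟨xy,y⟩ ⟨y,xy⟩ ⟨x,xy⟩ ⟨xy,x⟩ : Copy

first second : Copy → Label
first ⟨x,y⟩  = x
first ⟨y,x⟩  = y
first ⟨xy,y⟩ = xy
first ⟨y,xy⟩ = y
first ⟨x,xy⟩ = x
first ⟨xy,x⟩ = xy
second ⟨x,y⟩  = y
second ⟨y,x⟩  = x
second ⟨xy,y⟩ = y
second ⟨y,xy⟩ = xy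
second ⟨x,xy⟩ = xy
second ⟨xy,x⟩ = x

dualCopy : Copy → Copy
dualCopy ⟨x,y⟩  = ⟨y,x⟩
dualCopy ⟨y,x⟩  = ⟨x,y⟩
dualCopy ⟨xy,y⟩ = ⟨y,xy⟩
dualCopy ⟨y,xy⟩ = ⟨xy,y⟩
dualCopy ⟨x,xy⟩ = ⟨xy,x⟩
dualCopy ⟨xy,x⟩ = ⟨x,xy⟩

-- (f , s) ↦ (f s , s), the product being taken in the Klein group {1, x, y, xy}.
petrieCopy : Copy → Copy
petrieCopy ⟨x,y⟩  = ⟨xy,y⟩
petrieCopy ⟨xy,y⟩ = ⟨x,y⟩
petrieCopy ⟨y,x⟩  = ⟨xy,x⟩
petrieCopy ⟨xy,x⟩ = ⟨y,x⟩
petrieCopy ⟨y,xy⟩ = ⟨x,xy⟩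
petrieCopy ⟨x,xy⟩ = ⟨y,xy⟩

dualCopy-involutive : ∀ c → dualCopy (dualCopy c) ≡ c
dualCopy-involutive ⟨x,y⟩  = refl
dualCopy-involutive ⟨y,x⟩  = refl
dualCopy-involutive ⟨xy,y⟩ = refl
dualCopy-involutive ⟨y,xy⟩ = refl
dualCopy-involutive ⟨x,xy⟩ = refl
dualCopy-involutive ⟨xy,x⟩ = refl

petrieCopy-involutive : ∀ c → petrieCopy (petrieCopy c) ≡ c
petrieCopy-involutive ⟨x,y⟩  = refl
petrieCopy-involutive ⟨y,x⟩  = refl
petrieCopy-involutive ⟨xy,y⟩ = refl
petrieCopy-involutive ⟨y,xy⟩ = refl
petrieCopy-involutive ⟨x,xy⟩ = refl
petrieCopy-involutive ⟨xy,x⟩ = refl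

first-dualCopy : ∀ c → first (dualCopy c) ≡ second c
first-dualCopy ⟨x,y⟩  = refl
first-dualCopy ⟨y,x⟩  = refl
first-dualCopy ⟨xy,y⟩ = refl
first-dualCopy ⟨y,xy⟩ = refl
first-dualCopy ⟨x,xy⟩ = refl
first-dualCopy ⟨xy,x⟩ = refl

second-dualCopy : ∀ c → second (dualCopy c) ≡ first c
second-dualCopy c = trans (sym (first-dualCopy (dualCopy c))) (cong first (dualCopy-involutive c))

second-petrieCopy : ∀ c → second (petrieCopy c) ≡ second c
second-petrieCopy ⟨x,y⟩  = refl
second-petrieCopy ⟨y,x⟩  = refl
second-petrieCopy ⟨xy,y⟩ = refl
second-petrieCopy ⟨y,xy⟩ = refl
second-petrieCopy ⟨x,xy⟩ = refl
second-petrieCopy ⟨xy,x⟩ = refl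

enumerateCopy : Enumeration Copy
enumerateCopy = record { size = 6 ; index = index ; element = element ; element-index = element-index }
  where
  index : Copy → Fin 6
  index ⟨x,y⟩  = Fin.# 0
  index ⟨y,x⟩  = Fin.# 1
  index ⟨xy,y⟩ = Fin.# 2
  index ⟨y,xy⟩ = Fin.# 3
  index ⟨x,xy⟩ = Fin.# 4
  index ⟨xy,x⟩ = Fin.# 5
  element : Fin 6 → Copy
  element zero                                = ⟨x,y⟩
  element (suc zero)                          = ⟨y,x⟩
  element (suc (suc zero))                    = ⟨xy,y⟩
  element (suc (suc (suc zero)))              = ⟨y,xy⟩
  element (suc (suc (suc (suc zero))))        = ⟨x,xy⟩
  element (suc (suc (suc (suc (suc zero))))) = ⟨xy,x⟩
  element-index : ∀ c → element (index c) ≡ c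
  element-index ⟨x,y⟩  = refl
  element-index ⟨y,x⟩  = refl
  element-index ⟨xy,y⟩ = refl
  element-index ⟨y,xy⟩ = refl
  element-index ⟨x,xy⟩ = refl
  element-index ⟨xy,x⟩ = refl

module Symmetrisation {d : ℕ} (C : Configuration d) where
  open Configuration C

  ⟦_⟧ : Label → Point → Point
  ⟦ x ⟧  = X
  ⟦ y ⟧  = Y
  ⟦ xy ⟧ = X ∘ Y

  ⟦⟧-involutive : ∀ l p → ⟦ l ⟧ (⟦ l ⟧ p) ≡ p
  ⟦⟧-involutive x  p = X-involutive p
  ⟦⟧-involutive y  p = Y-involutive p
  ⟦⟧-involutive xy p = XY-involutive p

  ⟦⟧-commute : ∀ l l′ p → ⟦ l ⟧ (⟦ l′ ⟧ p) ≡ ⟦ l′ ⟧ (⟦ l ⟧ p)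
  ⟦⟧-commute x  x  p = refl
  ⟦⟧-commute y  y  p = refl
  ⟦⟧-commute xy xy p = refl
  ⟦⟧-commute x  y  p = XY-commute p
  ⟦⟧-commute y  x  p = sym (XY-commute p)
  ⟦⟧-commute x  xy p = cong X (XY-commute p)
  ⟦⟧-commute xy x  p = sym (cong X (XY-commute p))
  ⟦⟧-commute y  xy p = sym (XY-commute (Y p))
  ⟦⟧-commute xy y  p = XY-commute (Y p)

  ⟦⟧-square : ∀ l l′ p → ⟦ l ⟧ (⟦ l′ ⟧ (⟦ l ⟧ (⟦ l′ ⟧ p))) ≡ p
  ⟦⟧-square l l′ p = trans (cong ⟦ l ⟧ (⟦⟧-commute l′ l (⟦ l′ ⟧ p))) (trans (⟦⟧-involutive l _) (⟦⟧-involutive l′ p))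

  ⟦first-petrieCopy⟧ : ∀ c p → ⟦ first (petrieCopy c) ⟧ (⟦ second c ⟧ p) ≡ ⟦ first c ⟧ p
  ⟦first-petrieCopy⟧ ⟨x,y⟩  p = cong X (Y-involutive p)
  ⟦first-petrieCopy⟧ ⟨y,x⟩  p = trans (cong X (sym (XY-commute p))) (X-involutive (Y p))
  ⟦first-petrieCopy⟧ ⟨xy,y⟩ p = refl
  ⟦first-petrieCopy⟧ ⟨y,xy⟩ p = X-involutive (Y p)
  ⟦first-petrieCopy⟧ ⟨x,xy⟩ p = trans (sym (XY-commute (Y p))) (cong X (Y-involutive p))
  ⟦first-petrieCopy⟧ ⟨xy,x⟩ p = sym (XY-commute p)

  order : ∀ l → HasOrderᶠ (Z ∘ ⟦ l ⟧) d
  order x  = ZX-order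
  order y  = ZY-order
  order xy = ZXY-order

  Flag : Set
  Flag = Copy × Point

  gen : Fin 3 → Flag → Flag
  gen zero             (c , p) = c , ⟦ first c ⟧ p
  gen (suc zero)       (c , p) = c , ⟦ second c ⟧ p
  gen (suc (suc zero)) (c , p) = c , Z p

  gen-involutive : ∀ a t → gen a (gen a t) ≡ t
  gen-involutive zero             (c , p) = cong (c ,_) (⟦⟧-involutive (first c) p)
  gen-involutive (suc zero)       (c , p) = cong (c ,_) (⟦⟧-involutive (second c) p)
  gen-involutive (suc (suc zero)) (c , p) = cong (c ,_) (Z-involutive p)

  open WordGroup (enumerate-× enumerateCopy enumeration) gen gen-involutive

  xʷ yʷ zʷ : Word
  xʷ = [ zero ]
  yʷ = [ suc zero ]
  zʷ = [ suc (suc zero) ]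

  regularMap : RegularMap
  regularMap = record
    { G = group ; finite = finite ; x = xʷ ; y = yʷ ; z = zʷ
    ; x-inv = generator-isInvolution zero ((⟨x,y⟩ , proj₁ X-moves) , λ eq → proj₂ X-moves (cong proj₂ eq))
    ; y-inv = generator-isInvolution (suc zero) ((⟨y,x⟩ , proj₁ X-moves) , λ eq → proj₂ X-moves (cong proj₂ eq))
    ; z-inv = generator-isInvolution (suc (suc zero)) ((⟨x,y⟩ , proj₁ Z-moves) , λ eq → proj₂ Z-moves (cong proj₂ eq))
    ; xy-comm = λ (c , p) → cong (c ,_) (⟦⟧-square (first c) (second c) p)
    ; gen = λ w → w , evalWord-singletons _ (λ where zero t → refl ; (suc zero) t → refl ; (suc (suc zero)) t → refl) w
    }

  yz-order : HasOrderᶠ (act (yʷ ++ zʷ)) d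
  yz-order = hasOrder-fibrewise ⟨x,y⟩ (act (yʷ ++ zʷ)) (λ c → ⟦ second c ⟧ ∘ Z) (λ c p → refl) λ c →
    hasOrder-conjugate (Z ∘ ⟦ second c ⟧) (⟦ second c ⟧ ∘ Z) ⟦ second c ⟧ (⟦⟧-involutive (second c))
                       (λ p → refl) (order (second c))

  zx-order : HasOrderᶠ (act (zʷ ++ xʷ)) d
  zx-order = hasOrder-fibrewise ⟨x,y⟩ (act (zʷ ++ xʷ)) (λ c → Z ∘ ⟦ first c ⟧) (λ c p → refl) (order ∘ first)

  dualFlag petrieFlag : Flag → Flag
  dualFlag   (c , p) = dualCopy c , p
  petrieFlag (c , p) = petrieCopy c , p

  dualWord petrieWord : Fin 3 → Word
  dualWord zero               = yʷ
  dualWord (suc zero)         = xʷ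
  dualWord (suc (suc zero))   = zʷ
  petrieWord zero             = xʷ ++ yʷ
  petrieWord (suc zero)       = yʷ
  petrieWord (suc (suc zero)) = zʷ

  dualWord-conjugates : ∀ a t → act (dualWord a) (dualFlag t) ≡ dualFlag (gen a t)
  dualWord-conjugates zero             (c , p) = cong (λ l → dualCopy c , ⟦ l ⟧ p) (second-dualCopy c)
  dualWord-conjugates (suc zero)       (c , p) = cong (λ l → dualCopy c , ⟦ l ⟧ p) (first-dualCopy c)
  dualWord-conjugates (suc (suc zero)) (c , p) = refl

  petrieWord-conjugates : ∀ a t → act (petrieWord a) (petrieFlag t) ≡ petrieFlag (gen a t)
  petrieWord-conjugates zero             (c , p) = cong (petrieCopy c ,_)
    (trans (cong (λ l → ⟦ first (petrieCopy c) ⟧ (⟦ l ⟧ p)) (second-petrieCopy c)) (⟦first-petrieCopy⟧ c p))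
  petrieWord-conjugates (suc zero)       (c , p) = cong (λ l → petrieCopy c , ⟦ l ⟧ p) (second-petrieCopy c)
  petrieWord-conjugates (suc (suc zero)) (c , p) = refl

  selfDual : SelfDual regularMap
  selfDual = conjugationAutomorphism dualWord dualFlag (λ (c , p) → cong (_, p) (dualCopy-involutive c))
                                     dualWord-conjugates
           , (λ t → refl) , (λ t → refl) , (λ t → refl)

  selfPetrieDual : SelfPetrieDual regularMap
  selfPetrieDual = conjugationAutomorphism petrieWord petrieFlag (λ (c , p) → cong (_, p) (petrieCopy-involutive c))
                                           petrieWord-conjugates
                 , (λ t → refl) , (λ t → cong (gen zero) (gen-involutive (suc zero) t)) , (λ t → refl) , (λ t → refl)

  hasType : 3 ≤ d → HasType regularMap d d
  hasType 3≤d = hasOrder 1≤d yz-order , hasOrder 1≤d zx-order , 3≤d , 3≤d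
    where
    1≤d : 1 ≤ d
    1≤d = ≤-trans (s≤s z≤n) 3≤d

module _ {Point : Set} (Z W : Point → Point) where
  ZWalk WWalk : List Point → Set
  ZWalk []          = ⊥
  ZWalk (p ∷ [])    = Z p ≡ p
  ZWalk (p ∷ q ∷ r) = Z p ≡ q × WWalk (q ∷ r)
  WWalk []          = ⊥
  WWalk (p ∷ [])    = ⊥
  WWalk (p ∷ q ∷ r) = W p ≡ q × ZWalk (q ∷ r)

-- The orbit of e under ⟨Z, W⟩ is the path e ∷ rest of length d, and Z ∘ W fixes everything else.
record Chain {Point : Set} (Z W : Point → Point) (e : Point) (d : ℕ) : Set where
  field
    rest    : List Point
    length≡ : suc (length rest) ≡ d
    walk    : ZWalk Z W (e ∷ rest)
    e∉rest  : e ∉ rest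
    covers  : ∀ p → Z (W p) ≡ p ⊎ p ∈ e ∷ rest

chain-Ze≢e : ∀ {Point : Set} {Z W : Point → Point} {e d} → 1 < d → Chain Z W e d → Z e ≢ e
chain-Ze≢e 1<d record { rest = [] ; length≡ = 1≡d } _ = <⇒≢ 1<d 1≡d
chain-Ze≢e _ record { rest = p ∷ _ ; walk = (Ze≡p , _) ; e∉rest = e∉rest } Ze≡e =
  e∉rest (here (trans (sym Ze≡e) Ze≡p))

complement : ∀ h j → h < j → j < suc (h + h) → ∃ λ s → 1 ≤ s × s ≤ h × s + j ≡ suc (h + h)
complement h j h<j j<d = suc (h + h) ∸ j , m<n⇒0<n∸m j<d ,
  ≤-trans (∸-monoʳ-≤ (suc (h + h)) h<j) (≤-reflexive (m+n∸m≡n h h)) , m∸n+n≡m (<⇒≤ j<d)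

module ChainOrder {Point : Set} (Z W : Point → Point) (Z-involutive : ∀ p → Z (Z p) ≡ p)
                  (W-involutive : ∀ p → W (W p) ≡ p) (e : Point) (We≡e : W e ≡ e) where
  P Q : Point → Point
  P = Z ∘ W
  Q = W ∘ Z

  QP≡id : ∀ p → Q (P p) ≡ p
  QP≡id p = trans (cong W (Z-involutive (W p))) (W-involutive p)

  PQ≡id : ∀ p → P (Q p) ≡ p
  PQ≡id p = trans (cong Z (W-involutive (Z p))) (Z-involutive p)

  Pˢ Qˢ : ℕ → Point
  Pˢ s = fold e P s
  Qˢ s = fold e Q s

  Z-Qˢ : ∀ s → Z (Qˢ s) ≡ Pˢ (suc s)
  Z-Qˢ zero    = cong Z (sym We≡e)
  Z-Qˢ (suc s) = cong P (Z-Qˢ s)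

  W-Pˢ : ∀ s → W (Pˢ (suc s)) ≡ Qˢ (suc s)
  W-Pˢ s = cong W (sym (Z-Qˢ s))

  pairs : ℕ → ℕ → List Point
  pairs s zero    = []
  pairs s (suc h) = Pˢ s ∷ Qˢ s ∷ pairs (suc s) h

  length-pairs : ∀ s h → length (pairs s h) ≡ h + h
  length-pairs s zero    = refl
  length-pairs s (suc h) = cong suc (trans (cong suc (length-pairs (suc s) h)) (sym (+-suc h h)))

  ∈-pairs : ∀ s h s′ → s ≤ s′ → s′ < s + h → Pˢ s′ ∈ pairs s h × Qˢ s′ ∈ pairs s h
  ∈-pairs s zero    s′ s≤s′ s′<s+0 = ⊥-elim (<⇒≱ (subst (s′ <_) (+-identityʳ s) s′<s+0) s≤s′)
  ∈-pairs s (suc h) s′ s≤s′ s′<s+h with s ≟ s′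
  ... | yes refl = here refl , there (here refl)
  ... | no s≢s′  =
    let (P∈ , Q∈) = ∈-pairs (suc s) h s′ (≤∧≢⇒< s≤s′ s≢s′) (subst (s′ <_) (+-suc s h) s′<s+h)
    in there (there P∈) , there (there Q∈)

  ∈-pairs⁻ : ∀ s h p → p ∈ pairs s h → ∃ λ s′ → p ≡ Pˢ s′ ⊎ p ≡ Qˢ s′
  ∈-pairs⁻ s (suc h) p (here p≡)          = s , inj₁ p≡
  ∈-pairs⁻ s (suc h) p (there (here p≡))  = s , inj₂ p≡
  ∈-pairs⁻ s (suc h) p (there (there p∈)) = ∈-pairs⁻ (suc s) h p p∈

  walk⇒pairs : ∀ t r → ZWalk Z W (Qˢ t ∷ r) → ∃ λ h → r ≡ pairs (suc t) h × Z (Qˢ (h + t)) ≡ Qˢ (h + t)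
  walk⇒pairs t []          end                   = 0 , refl , end
  walk⇒pairs t (p ∷ [])    (_ , ())
  walk⇒pairs t (p ∷ q ∷ r) (Zv≡p , Wp≡q , walk) =
    let p≡ = trans (sym Zv≡p) (Z-Qˢ t)
        q≡ = trans (sym Wp≡q) (trans (cong W p≡) (W-Pˢ t))
        (h , r≡ , end) = walk⇒pairs (suc t) r (subst (λ v → ZWalk Z W (v ∷ r)) q≡ walk)
    in suc h , cong₂ _∷_ p≡ (cong₂ _∷_ q≡ r≡) , subst (λ k → Z (Qˢ k) ≡ Qˢ k) (+-suc h t) end

  chain-hasOrder : ∀ {d} → Chain Z W e d → HasOrderᶠ P d
  chain-hasOrder {d} chain = Pᵈ≡id , Pʲ≢id
    where
    open Chain chain
    open ≡-Reasoning

    h : ℕ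
    h = proj₁ (walk⇒pairs 0 rest walk)

    rest≡pairs : rest ≡ pairs 1 h
    rest≡pairs = proj₁ (proj₂ (walk⇒pairs 0 rest walk))

    Z-Qʰ : Z (Qˢ h) ≡ Qˢ h
    Z-Qʰ = subst (λ k → Z (Qˢ k) ≡ Qˢ k) (+-identityʳ h) (proj₂ (proj₂ (walk⇒pairs 0 rest walk)))

    d≡ : d ≡ suc (h + h)
    d≡ = trans (sym length≡) (cong suc (trans (cong length rest≡pairs) (length-pairs 1 h)))

    ∈rest : ∀ {p} → p ∈ pairs 1 h → p ∈ rest
    ∈rest = subst (_ ∈_) (sym rest≡pairs)

    Pᵈe≡e : Pˢ d ≡ e
    Pᵈe≡e = begin
      fold e P d            ≡⟨ cong (fold e P) (trans d≡ (sym (+-suc h h))) ⟩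
      fold e P (h + suc h)  ≡⟨ fold-+ e P h ⟩
      fold (Pˢ (suc h)) P h ≡⟨ cong (λ p → fold p P h) (trans (sym (Z-Qˢ h)) Z-Qʰ) ⟩
      fold (Qˢ h) P h       ≡⟨ fold-inverse Q P PQ≡id e h ⟩
      e                     ∎

    Pᵈ-Pˢ : ∀ s → fold (Pˢ s) P d ≡ Pˢ s
    Pᵈ-Pˢ s = trans (fold-commute P P (λ _ → refl) e s d) (cong (λ p → fold p P s) Pᵈe≡e)

    Pᵈ-Qˢ : ∀ s → fold (Qˢ s) P d ≡ Qˢ s
    Pᵈ-Qˢ s = trans (fold-commute P Q (λ p → trans (PQ≡id p) (sym (QP≡id p))) e s d)
                    (cong (λ p → fold p Q s) Pᵈe≡e)

    Pᵈ≡id : ∀ p → fold p P d ≡ p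
    Pᵈ≡id p with covers p
    ... | inj₁ fixed        = fold-fixed P fixed d
    ... | inj₂ (here refl)  = Pᵈe≡e
    ... | inj₂ (there p∈) with ∈-pairs⁻ 1 h p (subst (p ∈_) rest≡pairs p∈)
    ...   | s , inj₁ refl = Pᵈ-Pˢ s
    ...   | s , inj₂ refl = Pᵈ-Qˢ s

    -- For j ≤ h the point Pʲ e lies on rest; otherwise so does Q^(d - j) e = Pʲ e.
    Pʲ≢id : ∀ j → 1 ≤ j → j < d → ∃ λ p → fold p P j ≢ p
    Pʲ≢id j 1≤j j<d = e , λ Pʲe≡e → e∉rest (subst (_∈ rest) Pʲe≡e Pʲe∈rest)
      where
      Pʲe∈rest : Pˢ j ∈ rest
      Pʲe∈rest with j ≤? h
      ... | yes j≤h = ∈rest (proj₁ (∈-pairs 1 h j 1≤j (s≤s j≤h)))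
      ... | no  j≰h =
        let (s , 1≤s , s≤h , s+j≡d) = complement h j (≰⇒> j≰h) (subst (j <_) d≡ j<d)
            Qˢe≡Pʲe : Qˢ s ≡ Pˢ j
            Qˢe≡Pʲe = begin
              Qˢ s                        ≡⟨ cong (λ p → fold p Q s) (sym Pᵈe≡e) ⟩
              fold (Pˢ d) Q s             ≡⟨ cong (λ k → fold (Pˢ k) Q s) (trans d≡ (sym s+j≡d)) ⟩
              fold (Pˢ (s + j)) Q s       ≡⟨ cong (λ p → fold p Q s) (fold-+ e P s) ⟩
              fold (fold (Pˢ j) P s) Q s  ≡⟨ fold-inverse P Q QP≡id (Pˢ j) s ⟩
              Pˢ j                        ∎
        in subst (_∈ rest) Qˢe≡Pʲe (∈rest (proj₂ (∈-pairs 1 h s 1≤s (s≤s s≤h))))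

record ChainConfiguration (d : ℕ) : Set₁ where
  field
    involutions : Involutions
  open Involutions involutions public
  field
    e         : Point
    X-fixes-e : X e ≡ e
    Y-fixes-e : Y e ≡ e
    X-chain   : Chain Z X e d
    Y-chain   : Chain Z Y e d
    XY-chain  : Chain Z (X ∘ Y) e d

toConfiguration : ∀ {d} → ChainConfiguration d → Configuration d
toConfiguration C = record
  { involutions = involutions
  ; ZX-order  = ChainOrder.chain-hasOrder Z X Z-involutive X-involutive e X-fixes-e X-chain
  ; ZY-order  = ChainOrder.chain-hasOrder Z Y Z-involutive Y-involutive e Y-fixes-e Y-chain
  ; ZXY-order = ChainOrder.chain-hasOrder Z (X ∘ Y) Z-involutive XY-involutive e
                                          (trans (cong X Y-fixes-e) X-fixes-e) XY-chain
  }
  where open ChainConfiguration C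

data Port : Set where
  to-e to-q : Port

module _ {m : ℕ} (Wg : Fin m → Fin m) (Zg : Fin m → Fin m ⊎ Port) (exit : Fin m) where
  GadgetWWalk GadgetZWalk : List (Fin m) → Set
  GadgetWWalk []          = ⊥
  GadgetWWalk (g ∷ [])    = ⊥
  GadgetWWalk (g ∷ h ∷ r) = Wg g ≡ h × GadgetZWalk (h ∷ r)
  GadgetZWalk []          = ⊥
  GadgetZWalk (g ∷ [])    = g ≡ exit
  GadgetZWalk (g ∷ h ∷ r) = Zg g ≡ inj₁ h × GadgetWWalk (h ∷ r)

record GadgetPath {m : ℕ} (Wg : Fin m → Fin m) (Zg : Fin m → Fin m ⊎ Port) (entry exit : Fin m) : Set where
  field
    rest    : List (Fin m)
    length≡ : suc (length rest) ≡ m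
    walk    : GadgetWWalk Wg Zg exit (entry ∷ rest)
    covers  : ∀ g → g ∈ entry ∷ rest

-- Zg is Z on the gadget; the ports mark the two points that Z joins to e and to q = Z e.
record Gadget (m : ℕ) : Set where
  field
    Xg Yg          : Fin m → Fin m
    Xg-involutive  : ∀ g → Xg (Xg g) ≡ g
    Yg-involutive  : ∀ g → Yg (Yg g) ≡ g
    XYg-commute    : ∀ g → Xg (Yg g) ≡ Yg (Xg g)
    Zg             : Fin m → Fin m ⊎ Port
    entry exit     : Fin m
    Zg-entry       : Zg entry ≡ inj₂ to-e
    Zg-exit        : Zg exit ≡ inj₂ to-q
    to-e⇒entry     : ∀ g → Zg g ≡ inj₂ to-e → g ≡ entry
    to-q⇒exit      : ∀ g → Zg g ≡ inj₂ to-q → g ≡ exit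
    Zg-involutive  : ∀ g h → Zg g ≡ inj₁ h → Zg h ≡ inj₁ g
    X-path         : GadgetPath Xg Zg entry exit
    Y-path         : GadgetPath Yg Zg entry exit
    XY-path        : GadgetPath (Xg ∘ Yg) Zg entry exit

-- The Z-edge from e to q is cut and the gadget is inserted between e and q; since e is fixed by X
-- and Y, this edge begins all three chains, each of which therefore grows by m.
module Splice {d m : ℕ} (C : ChainConfiguration d) (1<d : 1 < d) (G : Gadget m) where
  open ChainConfiguration C
  open Gadget G
  open Enumeration enumeration using (≡-dec)

  Point′ : Set
  Point′ = Point ⊎ Fin m

  q : Point
  q = Z e

  q≢e : q ≢ e
  q≢e = chain-Ze≢e 1<d X-chain

  fromPort : Fin m ⊎ Port → Point′
  fromPort (inj₁ h)    = inj₂ h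
  fromPort (inj₂ to-e) = inj₁ e
  fromPort (inj₂ to-q) = inj₁ q

  X′ Y′ Z′ : Point′ → Point′
  X′ = Sum.map X Xg
  Y′ = Sum.map Y Yg
  Z′ (inj₁ p) with ≡-dec p e | ≡-dec p q
  ... | yes _ | _     = inj₂ entry
  ... | no _  | yes _ = inj₂ exit
  ... | no _  | no _  = inj₁ (Z p)
  Z′ (inj₂ g) = fromPort (Zg g)

  Z′-old : ∀ {p} → p ≢ e → p ≢ q → Z′ (inj₁ p) ≡ inj₁ (Z p)
  Z′-old {p} p≢e p≢q with ≡-dec p e | ≡-dec p q
  ... | yes p≡e | _       = ⊥-elim (p≢e p≡e)
  ... | no _    | yes p≡q = ⊥-elim (p≢q p≡q)
  ... | no _    | no _    = refl

  Z′-e : Z′ (inj₁ e) ≡ inj₂ entry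
  Z′-e with ≡-dec e e
  ... | yes _   = refl
  ... | no e≢e  = ⊥-elim (e≢e refl)

  Z′-q : Z′ (inj₁ q) ≡ inj₂ exit
  Z′-q with ≡-dec q e | ≡-dec q q
  ... | yes q≡e | _      = ⊥-elim (q≢e q≡e)
  ... | no _    | yes _  = refl
  ... | no _    | no q≢q = ⊥-elim (q≢q refl)

  Z′-involutive : ∀ t → Z′ (Z′ t) ≡ t
  Z′-involutive (inj₁ p) with ≡-dec p e | ≡-dec p q
  ... | yes refl | _        = cong fromPort Zg-entry
  ... | no _     | yes refl = cong fromPort Zg-exit
  ... | no p≢e   | no p≢q   = trans (Z′-old Zp≢e Zp≢q) (cong inj₁ (Z-involutive p))
    where
    Zp≢e : Z p ≢ e
    Zp≢e Zp≡e = p≢q (trans (sym (Z-involutive p)) (cong Z Zp≡e))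
    Zp≢q : Z p ≢ q
    Zp≢q Zp≡q = p≢e (trans (sym (Z-involutive p)) (trans (cong Z Zp≡q) (Z-involutive e)))
  Z′-involutive (inj₂ g) with Zg g in Zg≡
  ... | inj₁ h    = cong fromPort (Zg-involutive g h Zg≡)
  ... | inj₂ to-e = trans Z′-e (cong inj₂ (sym (to-e⇒entry g Zg≡)))
  ... | inj₂ to-q = trans Z′-q (cong inj₂ (sym (to-q⇒exit g Zg≡)))

  module _ (W : Point → Point) (Wg : Fin m → Fin m) (W′ : Point′ → Point′)
           (W′-old : ∀ p → W′ (inj₁ p) ≡ inj₁ (W p)) (W′-new : ∀ g → W′ (inj₂ g) ≡ inj₂ (Wg g))
           (W-involutive : ∀ p → W (W p) ≡ p) (W-fixes-e : W e ≡ e) where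

    lift-ZWalk : ∀ l → (∀ p → p ∈ l → p ≢ e) → ZWalk Z W l → ZWalk Z′ W′ (map inj₁ l)
    lift-WWalk : ∀ l → (∀ p → p ∈ l → p ≢ e) → WWalk Z W l → WWalk Z′ W′ (map inj₁ l)
    lift-ZWalk (p ∷ []) avoids Zp≡p = trans (Z′-old (avoids p (here refl)) p≢q) (cong inj₁ Zp≡p)
      where
      p≢q : p ≢ q
      p≢q refl = avoids p (here refl) (trans (sym Zp≡p) (Z-involutive e))
    lift-ZWalk (p ∷ p′ ∷ r) avoids (Zp≡p′ , walk) =
      trans (Z′-old (avoids p (here refl)) p≢q) (cong inj₁ Zp≡p′) , lift-WWalk (p′ ∷ r) (λ u → avoids u ∘ there) walk
      where
      p≢q : p ≢ q
      p≢q refl = avoids p′ (there (here refl)) (trans (sym Zp≡p′) (Z-involutive e))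
    lift-WWalk (p ∷ p′ ∷ r) avoids (Wp≡p′ , walk) =
      trans (W′-old p) (cong inj₁ Wp≡p′) , lift-ZWalk (p′ ∷ r) (λ u → avoids u ∘ there) walk

    gadget-WWalk : ∀ l r → GadgetWWalk Wg Zg exit l → WWalk Z′ W′ (inj₁ q ∷ r) →
                   WWalk Z′ W′ (map inj₂ l ++ inj₁ q ∷ r)
    gadget-ZWalk : ∀ l r → GadgetZWalk Wg Zg exit l → WWalk Z′ W′ (inj₁ q ∷ r) →
                   ZWalk Z′ W′ (map inj₂ l ++ inj₁ q ∷ r)
    gadget-WWalk (g ∷ g′ ∷ l) r (Wg≡g′ , walk) continue =
      trans (W′-new g) (cong inj₂ Wg≡g′) , gadget-ZWalk (g′ ∷ l) r walk continue
    gadget-ZWalk (g ∷ [])     r refl            continue = cong fromPort Zg-exit , continue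
    gadget-ZWalk (g ∷ g′ ∷ l) r (Zg≡g′ , walk) continue =
      cong fromPort Zg≡g′ , gadget-WWalk (g′ ∷ l) r walk continue

    spliceChain : Chain Z W e d → GadgetPath Wg Zg entry exit → Chain Z′ W′ (inj₁ e) (d + m)
    spliceChain record { rest = [] ; length≡ = 1≡d } _ = ⊥-elim (<⇒≢ 1<d 1≡d)
    spliceChain record { rest = .q ∷ rest₂ ; length≡ = length≡ ; walk = (refl , walk)
                       ; e∉rest = e∉rest ; covers = covers } path = record
      { rest    = rest′
      ; length≡ = length≡′
      ; walk    = Z′-e , gadget-WWalk (entry ∷ GP.rest) (map inj₁ rest₂) GP.walk
                                      (lift-WWalk (q ∷ rest₂) (λ p p∈ p≡e → e∉rest (subst (_∈ _) p≡e p∈)) walk)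
      ; e∉rest  = e∉rest′
      ; covers  = covers′
      }
      where
      module GP = GadgetPath path
      open ≡-Reasoning

      rest′ : List Point′
      rest′ = map inj₂ (entry ∷ GP.rest) ++ map inj₁ (q ∷ rest₂)

      length≡′ : suc (length rest′) ≡ d + m
      length≡′ = begin
        suc (length rest′)
          ≡⟨ cong suc (length-++ (map inj₂ (entry ∷ GP.rest))) ⟩
        suc (length (map inj₂ (entry ∷ GP.rest)) + length (map inj₁ (q ∷ rest₂)))
          ≡⟨ cong₂ (λ u v → suc (u + v)) (length-map inj₂ (entry ∷ GP.rest)) (length-map inj₁ (q ∷ rest₂)) ⟩
        suc (suc (length GP.rest) + length (q ∷ rest₂))
          ≡⟨ cong (λ u → suc (u + length (q ∷ rest₂))) GP.length≡ ⟩
        suc (m + length (q ∷ rest₂))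
          ≡⟨ cong suc (+-comm m _) ⟩
        suc (length (q ∷ rest₂)) + m
          ≡⟨ cong (_+ m) length≡ ⟩
        d + m ∎

      e∉rest′ : inj₁ e ∉ rest′
      e∉rest′ e∈ with ∈-++⁻ (map inj₂ (entry ∷ GP.rest)) e∈
      ... | inj₁ e∈gadget with ∈-map⁻ inj₂ e∈gadget
      ...   | _ , _ , ()
      e∉rest′ e∈ | inj₂ e∈old with ∈-map⁻ inj₁ e∈old
      ...   | _ , e∈ , refl = e∉rest e∈

      covers′ : ∀ t → Z′ (W′ t) ≡ t ⊎ t ∈ inj₁ e ∷ rest′
      covers′ (inj₂ g) = inj₂ (there (∈-++⁺ˡ (∈-map⁺ inj₂ (GP.covers g))))
      covers′ (inj₁ p) with covers p
      ... | inj₂ (here refl) = inj₂ (here refl)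
      ... | inj₂ (there p∈)  = inj₂ (there (∈-++⁺ʳ (map inj₂ (entry ∷ GP.rest)) (∈-map⁺ inj₁ p∈)))
      ... | inj₁ ZWp≡p with ≡-dec (W p) e | ≡-dec (W p) q
      ...   | yes Wp≡e | _        = inj₂ (here (cong inj₁ (trans (sym (W-involutive p)) (trans (cong W Wp≡e) W-fixes-e))))
      ...   | no _     | yes Wp≡q = inj₂ (here (cong inj₁ (trans (sym ZWp≡p) (trans (cong Z Wp≡q) (Z-involutive e)))))
      ...   | no Wp≢e  | no Wp≢q  = inj₁ (trans (cong Z′ (W′-old p)) (trans (Z′-old Wp≢e Wp≢q) (cong inj₁ ZWp≡p)))

  spliced : ChainConfiguration (d + m)
  spliced = record
    { involutions = record
      { Point        = Point′
      ; enumeration  = enumerate-⊎ enumeration (enumerateFin m)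
      ; X            = X′
      ; Y            = Y′
      ; Z            = Z′
      ; X-involutive = λ t → trans (Sumₚ.map-map t) (trans (Sumₚ.map-cong X-involutive Xg-involutive t) (Sumₚ.map-id t))
      ; Y-involutive = λ t → trans (Sumₚ.map-map t) (trans (Sumₚ.map-cong Y-involutive Yg-involutive t) (Sumₚ.map-id t))
      ; Z-involutive = Z′-involutive
      ; XY-commute   = λ t → trans (Sumₚ.map-map t) (trans (Sumₚ.map-cong XY-commute XYg-commute t) (sym (Sumₚ.map-map t)))
      ; X-moves      = inj₁ (proj₁ X-moves) , λ X′p≡p → proj₂ X-moves (Sumₚ.inj₁-injective X′p≡p)
      ; Z-moves      = inj₁ e , λ Z′e≡e → entry≢e (trans (sym Z′-e) Z′e≡e)
      }
    ; e         = inj₁ e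
    ; X-fixes-e = cong inj₁ X-fixes-e
    ; Y-fixes-e = cong inj₁ Y-fixes-e
    ; X-chain   = spliceChain X Xg X′ (λ _ → refl) (λ _ → refl) X-involutive X-fixes-e X-chain X-path
    ; Y-chain   = spliceChain Y Yg Y′ (λ _ → refl) (λ _ → refl) Y-involutive Y-fixes-e Y-chain Y-path
    ; XY-chain  = spliceChain (X ∘ Y) (Xg ∘ Yg) (X′ ∘ Y′) (λ _ → refl) (λ _ → refl) XY-involutive
                              (trans (cong X Y-fixes-e) X-fixes-e) XY-chain XY-path
    }
    where
    entry≢e : inj₂ entry ≢ inj₁ e
    entry≢e ()

hasOrder? : ∀ {n} (f : Fin n → Fin n) d → Dec (HasOrderᶠ f d)
hasOrder? f d =
  Finₚ.all? (λ a → fold a f d Fin.≟ a) ×-dec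
  map′ (λ moves j 1≤j j<d → moves {j} j<d 1≤j) (λ moves {j} j<d 1≤j → moves j 1≤j j<d)
       (allUpTo? (λ j → (1 ≤? j) →-dec Finₚ.any? (λ a → ¬? (fold a f j Fin.≟ a))) d)

module _ {n : ℕ} (Z W : Fin n → Fin n) where
  open import Data.List.Membership.DecPropositional (Fin._≟_ {n}) using (_∈?_)

  zWalk? : (l : List (Fin n)) → Dec (ZWalk Z W l)
  wWalk? : (l : List (Fin n)) → Dec (WWalk Z W l)
  zWalk? []          = no λ ()
  zWalk? (p ∷ [])    = Z p Fin.≟ p
  zWalk? (p ∷ q ∷ r) = (Z p Fin.≟ q) ×-dec wWalk? (q ∷ r)
  wWalk? []          = no λ ()
  wWalk? (p ∷ [])    = no λ ()
  wWalk? (p ∷ q ∷ r) = (W p Fin.≟ q) ×-dec zWalk? (q ∷ r)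

  chain! : (e : Fin n) (rest : List (Fin n)) →
           {True (zWalk? (e ∷ rest))} → {True (¬? (e ∈? rest))} →
           {True (Finₚ.all? λ p → (Z (W p) Fin.≟ p) ⊎-dec (p ∈? e ∷ rest))} →
           Chain Z W e (suc (length rest))
  chain! e rest {walk} {e∉rest} {covers} =
    record { rest = rest ; length≡ = refl ; walk = toWitness walk ; e∉rest = toWitness e∉rest ; covers = toWitness covers }

_≟ᴾ_ : DecidableEquality Port
to-e ≟ᴾ to-e = yes refl
to-e ≟ᴾ to-q = no λ ()
to-q ≟ᴾ to-e = no λ ()
to-q ≟ᴾ to-q = yes refl

module _ {m : ℕ} (Wg : Fin m → Fin m) (Zg : Fin m → Fin m ⊎ Port) (entry exit : Fin m) where
  open import Data.List.Membership.DecPropositional (Fin._≟_ {m}) using (_∈?_)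

  gadgetWWalk? : (l : List (Fin m)) → Dec (GadgetWWalk Wg Zg exit l)
  gadgetZWalk? : (l : List (Fin m)) → Dec (GadgetZWalk Wg Zg exit l)
  gadgetWWalk? []          = no λ ()
  gadgetWWalk? (g ∷ [])    = no λ ()
  gadgetWWalk? (g ∷ h ∷ r) = (Wg g Fin.≟ h) ×-dec gadgetZWalk? (h ∷ r)
  gadgetZWalk? []          = no λ ()
  gadgetZWalk? (g ∷ [])    = g Fin.≟ exit
  gadgetZWalk? (g ∷ h ∷ r) = Sumₚ.≡-dec Fin._≟_ _≟ᴾ_ (Zg g) (inj₁ h) ×-dec gadgetWWalk? (h ∷ r)

  gadgetPath! : (rest : List (Fin m)) →
                {True (suc (length rest) ≟ m)} → {True (gadgetWWalk? (entry ∷ rest))} →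
                {True (Finₚ.all? λ g → g ∈? entry ∷ rest)} →
                GadgetPath Wg Zg entry exit
  gadgetPath! rest {length≡} {walk} {covers} =
    record { rest = rest ; length≡ = toWitness length≡ ; walk = toWitness walk ; covers = toWitness covers }

involutions! : ∀ {n} (X Y Z : Fin n → Fin n) →
               {True (Finₚ.all? λ p → X (X p) Fin.≟ p)} → {True (Finₚ.all? λ p → Y (Y p) Fin.≟ p)} →
               {True (Finₚ.all? λ p → Z (Z p) Fin.≟ p)} → {True (Finₚ.all? λ p → X (Y p) Fin.≟ Y (X p))} →
               {True (Finₚ.any? λ p → ¬? (X p Fin.≟ p))} → {True (Finₚ.any? λ p → ¬? (Z p Fin.≟ p))} →
               Involutions
involutions! {n} X Y Z {XX} {YY} {ZZ} {XY} {X-moves} {Z-moves} = record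
  { Point = Fin n ; enumeration = enumerateFin n ; X = X ; Y = Y ; Z = Z
  ; X-involutive = toWitness XX ; Y-involutive = toWitness YY ; Z-involutive = toWitness ZZ
  ; XY-commute = toWitness XY ; X-moves = toWitness X-moves ; Z-moves = toWitness Z-moves
  }

configuration5 : Configuration 5
configuration5 = record
  { involutions = involutions! X Y Z
  ; ZX-order    = from-yes (hasOrder? (Z ∘ X) 5)
  ; ZY-order    = from-yes (hasOrder? (Z ∘ Y) 5)
  ; ZXY-order   = from-yes (hasOrder? (Z ∘ X ∘ Y) 5)
  }
  where
  X Y Z : Fin 11 → Fin 11
  X = Vec.lookup (# 0 ∷ # 1 ∷ # 2 ∷ # 4 ∷ # 3 ∷ # 6 ∷ # 5 ∷ # 8 ∷ # 7 ∷ # 10 ∷ # 9 ∷ [])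
  Y = Vec.lookup (# 0 ∷ # 2 ∷ # 1 ∷ # 3 ∷ # 4 ∷ # 6 ∷ # 5 ∷ # 9 ∷ # 10 ∷ # 7 ∷ # 8 ∷ [])
  Z = Vec.lookup (# 7 ∷ # 1 ∷ # 9 ∷ # 3 ∷ # 10 ∷ # 5 ∷ # 8 ∷ # 0 ∷ # 6 ∷ # 2 ∷ # 4 ∷ [])

configuration7 : Configuration 7
configuration7 = record
  { involutions = involutions! X Y Z
  ; ZX-order    = from-yes (hasOrder? (Z ∘ X) 7)
  ; ZY-order    = from-yes (hasOrder? (Z ∘ Y) 7)
  ; ZXY-order   = from-yes (hasOrder? (Z ∘ X ∘ Y) 7)
  }
  where
  X Y Z : Fin 14 → Fin 14
  X = Vec.lookup (# 0 ∷ # 1 ∷ # 3 ∷ # 2 ∷ # 5 ∷ # 4 ∷ # 7 ∷ # 6 ∷ # 9 ∷ # 8 ∷ # 11 ∷ # 10 ∷ # 13 ∷ # 12 ∷ [])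
  Y = Vec.lookup (# 1 ∷ # 0 ∷ # 2 ∷ # 3 ∷ # 5 ∷ # 4 ∷ # 8 ∷ # 9 ∷ # 6 ∷ # 7 ∷ # 12 ∷ # 13 ∷ # 10 ∷ # 11 ∷ [])
  Z = Vec.lookup (# 2 ∷ # 4 ∷ # 0 ∷ # 6 ∷ # 1 ∷ # 10 ∷ # 3 ∷ # 13 ∷ # 11 ∷ # 9 ∷ # 5 ∷ # 8 ∷ # 12 ∷ # 7 ∷ [])

configuration15 : Configuration 15
configuration15 = record
  { involutions = involutions! X Y Z
  ; ZX-order    = from-yes (hasOrder? (Z ∘ X) 15)
  ; ZY-order    = from-yes (hasOrder? (Z ∘ Y) 15)
  ; ZXY-order   = from-yes (hasOrder? (Z ∘ X ∘ Y) 15)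
  }
  where
  X Y Z : Fin 17 → Fin 17
  X = Vec.lookup (# 0 ∷ # 2 ∷ # 1 ∷ # 4 ∷ # 3 ∷ # 6 ∷ # 5 ∷ # 8 ∷ # 7 ∷ # 10 ∷ # 9 ∷ # 12 ∷ # 11 ∷ # 14 ∷ # 13 ∷ # 16 ∷ # 15 ∷ [])
  Y = Vec.lookup (# 0 ∷ # 3 ∷ # 4 ∷ # 1 ∷ # 2 ∷ # 7 ∷ # 8 ∷ # 5 ∷ # 6 ∷ # 11 ∷ # 12 ∷ # 9 ∷ # 10 ∷ # 15 ∷ # 16 ∷ # 13 ∷ # 14 ∷ [])
  Z = Vec.lookup (# 1 ∷ # 0 ∷ # 8 ∷ # 9 ∷ # 5 ∷ # 4 ∷ # 7 ∷ # 6 ∷ # 2 ∷ # 3 ∷ # 14 ∷ # 11 ∷ # 13 ∷ # 12 ∷ # 10 ∷ # 16 ∷ # 15 ∷ [])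

chainConfiguration9 : ChainConfiguration 9
chainConfiguration9 = record
  { involutions = involutions! X Y Z
  ; e = # 0 ; X-fixes-e = refl ; Y-fixes-e = refl
  ; X-chain  = chain! Z X (# 0) (# 1 ∷ # 2 ∷ # 5 ∷ # 6 ∷ # 3 ∷ # 4 ∷ # 8 ∷ # 7 ∷ [])
  ; Y-chain  = chain! Z Y (# 0) (# 1 ∷ # 3 ∷ # 6 ∷ # 8 ∷ # 4 ∷ # 2 ∷ # 5 ∷ # 7 ∷ [])
  ; XY-chain = chain! Z (X ∘ Y) (# 0) (# 1 ∷ # 4 ∷ # 8 ∷ # 5 ∷ # 2 ∷ # 3 ∷ # 6 ∷ # 7 ∷ [])
  }
  where
  X Y Z : Fin 9 → Fin 9
  X = Vec.lookup (# 0 ∷ # 2 ∷ # 1 ∷ # 4 ∷ # 3 ∷ # 6 ∷ # 5 ∷ # 8 ∷ # 7 ∷ [])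
  Y = Vec.lookup (# 0 ∷ # 3 ∷ # 4 ∷ # 1 ∷ # 2 ∷ # 7 ∷ # 8 ∷ # 5 ∷ # 6 ∷ [])
  Z = Vec.lookup (# 1 ∷ # 0 ∷ # 5 ∷ # 6 ∷ # 8 ∷ # 2 ∷ # 3 ∷ # 7 ∷ # 4 ∷ [])

chainConfiguration11 : ChainConfiguration 11
chainConfiguration11 = record
  { involutions = involutions! X Y Z
  ; e = # 0 ; X-fixes-e = refl ; Y-fixes-e = refl
  ; X-chain  = chain! Z X (# 0) (# 1 ∷ # 2 ∷ # 3 ∷ # 4 ∷ # 5 ∷ # 6 ∷ # 8 ∷ # 7 ∷ # 9 ∷ # 10 ∷ [])
  ; Y-chain  = chain! Z Y (# 0) (# 1 ∷ # 3 ∷ # 2 ∷ # 4 ∷ # 5 ∷ # 7 ∷ # 9 ∷ # 11 ∷ # 12 ∷ # 10 ∷ [])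
  ; XY-chain = chain! Z (X ∘ Y) (# 0) (# 1 ∷ # 4 ∷ # 5 ∷ # 8 ∷ # 6 ∷ # 7 ∷ # 9 ∷ # 12 ∷ # 11 ∷ # 10 ∷ [])
  }
  where
  X Y Z : Fin 13 → Fin 13
  X = Vec.lookup (# 0 ∷ # 2 ∷ # 1 ∷ # 4 ∷ # 3 ∷ # 6 ∷ # 5 ∷ # 8 ∷ # 7 ∷ # 10 ∷ # 9 ∷ # 12 ∷ # 11 ∷ [])
  Y = Vec.lookup (# 0 ∷ # 3 ∷ # 4 ∷ # 1 ∷ # 2 ∷ # 7 ∷ # 8 ∷ # 5 ∷ # 6 ∷ # 11 ∷ # 12 ∷ # 9 ∷ # 10 ∷ [])
  Z = Vec.lookup (# 1 ∷ # 0 ∷ # 3 ∷ # 2 ∷ # 5 ∷ # 4 ∷ # 8 ∷ # 9 ∷ # 6 ∷ # 7 ∷ # 10 ∷ # 12 ∷ # 11 ∷ [])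

chainConfiguration13 : ChainConfiguration 13
chainConfiguration13 = record
  { involutions = involutions! X Y Z
  ; e = # 0 ; X-fixes-e = refl ; Y-fixes-e = refl
  ; X-chain  = chain! Z X (# 0) (# 1 ∷ # 2 ∷ # 5 ∷ # 6 ∷ # 3 ∷ # 4 ∷ # 9 ∷ # 10 ∷ # 7 ∷ # 8 ∷ # 12 ∷ # 11 ∷ [])
  ; Y-chain  = chain! Z Y (# 0) (# 1 ∷ # 3 ∷ # 6 ∷ # 8 ∷ # 12 ∷ # 10 ∷ # 7 ∷ # 5 ∷ # 2 ∷ # 4 ∷ # 9 ∷ # 11 ∷ [])
  ; XY-chain = chain! Z (X ∘ Y) (# 0) (# 1 ∷ # 4 ∷ # 9 ∷ # 12 ∷ # 8 ∷ # 5 ∷ # 2 ∷ # 3 ∷ # 6 ∷ # 7 ∷ # 10 ∷ # 11 ∷ [])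
  }
  where
  X Y Z : Fin 13 → Fin 13
  X = Vec.lookup (# 0 ∷ # 2 ∷ # 1 ∷ # 4 ∷ # 3 ∷ # 6 ∷ # 5 ∷ # 8 ∷ # 7 ∷ # 10 ∷ # 9 ∷ # 12 ∷ # 11 ∷ [])
  Y = Vec.lookup (# 0 ∷ # 3 ∷ # 4 ∷ # 1 ∷ # 2 ∷ # 7 ∷ # 8 ∷ # 5 ∷ # 6 ∷ # 11 ∷ # 12 ∷ # 9 ∷ # 10 ∷ [])
  Z = Vec.lookup (# 1 ∷ # 0 ∷ # 5 ∷ # 6 ∷ # 9 ∷ # 2 ∷ # 3 ∷ # 10 ∷ # 12 ∷ # 4 ∷ # 7 ∷ # 11 ∷ # 8 ∷ [])

gadget8 : Gadget 8
gadget8 = record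
  { Xg = Xg ; Yg = Yg ; Zg = Zg ; entry = # 0 ; exit = # 6 ; Zg-entry = refl ; Zg-exit = refl
  ; Xg-involutive = from-yes (Finₚ.all? λ g → Xg (Xg g) Fin.≟ g)
  ; Yg-involutive = from-yes (Finₚ.all? λ g → Yg (Yg g) Fin.≟ g)
  ; XYg-commute   = from-yes (Finₚ.all? λ g → Xg (Yg g) Fin.≟ Yg (Xg g))
  ; to-e⇒entry    = from-yes (Finₚ.all? λ g → (Zg g ≟ˡ inj₂ to-e) →-dec (g Fin.≟ # 0))
  ; to-q⇒exit     = from-yes (Finₚ.all? λ g → (Zg g ≟ˡ inj₂ to-q) →-dec (g Fin.≟ # 6))
  ; Zg-involutive = from-yes (Finₚ.all? λ g → Finₚ.all? λ h → (Zg g ≟ˡ inj₁ h) →-dec (Zg h ≟ˡ inj₁ g))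
  ; X-path  = gadgetPath! Xg Zg (# 0) (# 6) (# 1 ∷ # 4 ∷ # 5 ∷ # 2 ∷ # 3 ∷ # 7 ∷ # 6 ∷ [])
  ; Y-path  = gadgetPath! Yg Zg (# 0) (# 6) (# 2 ∷ # 5 ∷ # 7 ∷ # 3 ∷ # 1 ∷ # 4 ∷ # 6 ∷ [])
  ; XY-path = gadgetPath! (Xg ∘ Yg) Zg (# 0) (# 6) (# 3 ∷ # 7 ∷ # 4 ∷ # 1 ∷ # 2 ∷ # 5 ∷ # 6 ∷ [])
  }
  where
  Xg Yg : Fin 8 → Fin 8
  Xg = Vec.lookup (# 1 ∷ # 0 ∷ # 3 ∷ # 2 ∷ # 5 ∷ # 4 ∷ # 7 ∷ # 6 ∷ [])
  Yg = Vec.lookup (# 2 ∷ # 3 ∷ # 0 ∷ # 1 ∷ # 6 ∷ # 7 ∷ # 4 ∷ # 5 ∷ [])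
  Zg : Fin 8 → Fin 8 ⊎ Port
  Zg = Vec.lookup (inj₂ to-e ∷ inj₁ (# 4) ∷ inj₁ (# 5) ∷ inj₁ (# 7) ∷ inj₁ (# 1) ∷ inj₁ (# 2) ∷ inj₂ to-q ∷ inj₁ (# 3) ∷ [])
  _≟ˡ_ : DecidableEquality (Fin 8 ⊎ Port)
  _≟ˡ_ = Sumₚ.≡-dec Fin._≟_ _≟ᴾ_

gadget12 : Gadget 12
gadget12 = record
  { Xg = Xg ; Yg = Yg ; Zg = Zg ; entry = # 0 ; exit = # 4 ; Zg-entry = refl ; Zg-exit = refl
  ; Xg-involutive = from-yes (Finₚ.all? λ g → Xg (Xg g) Fin.≟ g)
  ; Yg-involutive = from-yes (Finₚ.all? λ g → Yg (Yg g) Fin.≟ g)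
  ; XYg-commute   = from-yes (Finₚ.all? λ g → Xg (Yg g) Fin.≟ Yg (Xg g))
  ; to-e⇒entry    = from-yes (Finₚ.all? λ g → (Zg g ≟ˡ inj₂ to-e) →-dec (g Fin.≟ # 0))
  ; to-q⇒exit     = from-yes (Finₚ.all? λ g → (Zg g ≟ˡ inj₂ to-q) →-dec (g Fin.≟ # 4))
  ; Zg-involutive = from-yes (Finₚ.all? λ g → Finₚ.all? λ h → (Zg g ≟ˡ inj₁ h) →-dec (Zg h ≟ˡ inj₁ g))
  ; X-path  = gadgetPath! Xg Zg (# 0) (# 4) (# 1 ∷ # 6 ∷ # 7 ∷ # 10 ∷ # 11 ∷ # 3 ∷ # 2 ∷ # 8 ∷ # 9 ∷ # 5 ∷ # 4 ∷ [])
  ; Y-path  = gadgetPath! Yg Zg (# 0) (# 4) (# 2 ∷ # 8 ∷ # 10 ∷ # 7 ∷ # 5 ∷ # 9 ∷ # 11 ∷ # 3 ∷ # 1 ∷ # 6 ∷ # 4 ∷ [])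
  ; XY-path = gadgetPath! (Xg ∘ Yg) Zg (# 0) (# 4) (# 3 ∷ # 11 ∷ # 8 ∷ # 2 ∷ # 1 ∷ # 6 ∷ # 5 ∷ # 9 ∷ # 10 ∷ # 7 ∷ # 4 ∷ [])
  }
  where
  Xg Yg : Fin 12 → Fin 12
  Xg = Vec.lookup (# 1 ∷ # 0 ∷ # 3 ∷ # 2 ∷ # 5 ∷ # 4 ∷ # 7 ∷ # 6 ∷ # 9 ∷ # 8 ∷ # 11 ∷ # 10 ∷ [])
  Yg = Vec.lookup (# 2 ∷ # 3 ∷ # 0 ∷ # 1 ∷ # 6 ∷ # 7 ∷ # 4 ∷ # 5 ∷ # 10 ∷ # 11 ∷ # 8 ∷ # 9 ∷ [])
  Zg : Fin 12 → Fin 12 ⊎ Port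
  Zg = Vec.lookup (inj₂ to-e ∷ inj₁ (# 6) ∷ inj₁ (# 8) ∷ inj₁ (# 11) ∷ inj₂ to-q ∷ inj₁ (# 9) ∷ inj₁ (# 1)
                   ∷ inj₁ (# 10) ∷ inj₁ (# 2) ∷ inj₁ (# 5) ∷ inj₁ (# 7) ∷ inj₁ (# 3) ∷ [])
  _≟ˡ_ : DecidableEquality (Fin 12 ⊎ Port)
  _≟ˡ_ = Sumₚ.≡-dec Fin._≟_ _≟ᴾ_

splice : ∀ {d m} → 1 < d → Gadget m → ChainConfiguration d → ChainConfiguration (d + m)
splice 1<d G C = Splice.spliced C 1<d G

-- Splicing in 8-gadgets reaches every odd d ≥ 9 except 15; its class modulo 8 starts at 23 = 11 + 12.
chainConfiguration : ∀ k → ChainConfiguration (9 + 2 * k) ⊎ k ≡ 3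
chainConfiguration 0 = inj₁ chainConfiguration9
chainConfiguration 1 = inj₁ chainConfiguration11
chainConfiguration 2 = inj₁ chainConfiguration13
chainConfiguration 3 = inj₂ refl
chainConfiguration (suc (suc (suc (suc k)))) with chainConfiguration k
... | inj₁ C    = inj₁ (subst ChainConfiguration (+8 k) (splice (s≤s (s≤s z≤n)) gadget8 C))
  where
  +8 : ∀ k → 9 + 2 * k + 8 ≡ 9 + 2 * (4 + k)
  +8 = solve-∀
... | inj₂ refl = inj₁ (splice (s≤s (s≤s z≤n)) gadget12 chainConfiguration11)

configuration : ∀ m → 2 ≤ m → Configuration (suc (2 * m))
configuration 1 (s≤s ())
configuration 2 _ = configuration5
configuration 3 _ = configuration7
configuration (suc (suc (suc (suc k)))) _ with chainConfiguration k
... | inj₁ C    = subst Configuration (9+2k k) (toConfiguration C)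
  where
  9+2k : ∀ k → 9 + 2 * k ≡ suc (2 * (4 + k))
  9+2k = solve-∀
... | inj₂ refl = configuration15

5≤2m+1⇒2≤m : ∀ m → 5 ≤ suc (2 * m) → 2 ≤ m
5≤2m+1⇒2≤m 0             (s≤s ())
5≤2m+1⇒2≤m 1             (s≤s (s≤s (s≤s ())))
5≤2m+1⇒2≤m (suc (suc m)) _ = s≤s (s≤s z≤n)

theorem4p3 : ∀ (d : ℕ) → (∃ λ m → d ≡ suc (2 * m)) → 5 ≤ d →
    Σ RegularMap λ M → (∃ λ l → HasType M d l) × HasValency M d × SelfDual M × SelfPetrieDual M
theorem4p3 d (m , refl) 5≤d = regularMap , (d , type) , proj₁ type , selfDual , selfPetrieDual
  where
  open Symmetrisation (configuration m (5≤2m+1⇒2≤m m 5≤d))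
  type : HasType regularMap d d
  type = hasType (≤-trans (s≤s (s≤s (s≤s z≤n))) 5≤d)
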